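{- Let $n$ be a non-negative integer. If $\{(\bar s_k),(\bar\sigma_k)\}$ and $\{(\bar t_k),(\bar\tau_k)\}$, $k=0,1,2,\ldots$, are binomial-transform pairs of the second kind, then \[ \sum_{k=0}^n (-1)^k\binom{n}{k}\bar s_k\,\bar t_{n-k} = \sum_{k=0}^n (-1)^k\binom{n}{k}\bar\sigma_k\,\bar\tau_{n-k}. \]
   Context: Two sequences $(\bar s_k)_{k\ge0}$ and $(\bar\sigma_k)_{k\ge0}$ of complex numbers form a binomial-transform pair of the second kind if $\bar\sigma_n=\sum_{k=0}^n\binom nk \bar s_k$ for every non-negative integer $n$ (equivalently, $\bar s_n=\sum_{k=0}^n(-1)^{n-k}\binom nk\bar\sigma_k$ for every $n\ge0$). -}

module Defs where

open import Level using (Level)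
open import Data.Nat using (ℕ; zero; suc)
open import Data.Nat.Combinatorics using (_C_)
open import Algebra.Bundles using (CommutativeRing)

-- Generic notions over an arbitrary commutative ring R
-- (the paper works in ℂ).
module _ {c ℓ : Level} (R : CommutativeRing c ℓ) where
  open CommutativeRing R

  sumTo : ℕ → (ℕ → Carrier) → Carrier
  sumTo zero    f = f 0
  sumTo (suc n) f = sumTo n f + f (suc n)

  natMul : ℕ → Carrier → Carrier
  natMul zero    x = 0#
  natMul (suc m) x = x + natMul m x

  negOnePow : ℕ → Carrier
  negOnePow zero    = 1#
  negOnePow (suc k) = (- 1#) * negOnePow k

  IsBinomialPair2 : (ℕ → Carrier) → (ℕ → Carrier) → Set ℓ
  IsBinomialPair2 s σ = ∀ n → σ n ≈ sumTo n (λ k → natMul (n C k) (s k))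

-- Let E be the shift (E a) k = a (k + 1) and T the binomial transform. The sum
-- B n a b = Σ (-1)^k C(n,k) a k b (n - k) satisfies B (n+1) a b = B n a (E b) - B n (E a) b,
-- so it is the (0,0) entry of (E_b - E_a)^n applied to a ⊗ b. Pascal's rule gives
-- E ∘ T = T ∘ (1 + E), so passing to (T a, T b) replaces E_a, E_b by 1 + E_a, 1 + E_b,
-- which leaves the difference E_b - E_a, and hence B, unchanged.
module Submission where

open import Defs
open import Level using (Level)
open import Data.Nat using (ℕ; _∸_)
open import Data.Nat.Combinatorics using (_C_; nCk+nC[k+1]≡[n+1]C[k+1])
open import Algebra.Bundles using (CommutativeRing)

open import Data.Nat.Base using (zero; suc; _≤_; z≤n) renaming (_+_ to _+ℕ_)
open import Data.Nat.Combinatorics.Specification using (k>n⇒nCk≡0)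
open import Data.Nat.Properties using (≤-refl; m≤n⇒m≤1+n; n<1+n; +-∸-assoc)
open import Relation.Binary.PropositionalEquality as ≡ using (_≡_; cong)
import Algebra.Properties.Ring as RingProperties
import Algebra.Properties.Semiring.Mult as SemiringMult
import Algebra.Properties.CommutativeMonoid.Mult as CommutativeMonoidMult
import Algebra.Properties.CommutativeSemigroup as CommutativeSemigroupProperties
import Relation.Binary.Reasoning.Setoid as SetoidReasoning

module BinomialConvolution {c ℓ : Level} (R : CommutativeRing c ℓ) where
  open CommutativeRing R hiding (zero)
  open SemiringMult semiring using (_×_; ×-congʳ; ×-homo-+; ×-comm-*)
  open CommutativeMonoidMult +-commutativeMonoid using (×-distrib-+)
  open CommutativeSemigroupProperties +-commutativeSemigroup using (interchange)
  open RingProperties ring using (-1*x≈-x; -‿+-comm)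
  open SetoidReasoning setoid

  Seq : Set c
  Seq = ℕ → Carrier

  shift : Seq → Seq
  shift a k = a (suc k)

  sumTo-cong : ∀ n {f g : Seq} → (∀ {k} → k ≤ n → f k ≈ g k) → sumTo R n f ≈ sumTo R n g
  sumTo-cong zero    f≈g = f≈g z≤n
  sumTo-cong (suc n) f≈g = +-cong (sumTo-cong n (λ k≤n → f≈g (m≤n⇒m≤1+n k≤n))) (f≈g ≤-refl)

  sumTo-distrib-+ : ∀ n (f g : Seq) → sumTo R n (λ k → f k + g k) ≈ sumTo R n f + sumTo R n g
  sumTo-distrib-+ zero    f g = refl
  sumTo-distrib-+ (suc n) f g = begin
    sumTo R n (λ k → f k + g k) + (f (suc n) + g (suc n))  ≈⟨ +-congʳ (sumTo-distrib-+ n f g) ⟩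
    (sumTo R n f + sumTo R n g) + (f (suc n) + g (suc n))  ≈⟨ interchange _ _ _ _ ⟩
    sumTo R (suc n) f + sumTo R (suc n) g                  ∎

  *-distribˡ-sumTo : ∀ n x (f : Seq) → x * sumTo R n f ≈ sumTo R n (λ k → x * f k)
  *-distribˡ-sumTo zero    x f = refl
  *-distribˡ-sumTo (suc n) x f = begin
    x * (sumTo R n f + f (suc n))                ≈⟨ distribˡ x _ _ ⟩
    x * sumTo R n f + x * f (suc n)              ≈⟨ +-congʳ (*-distribˡ-sumTo n x f) ⟩
    sumTo R n (λ k → x * f k) + x * f (suc n)    ∎

  sumTo-suc : ∀ n (f : Seq) → sumTo R (suc n) f ≈ f 0 + sumTo R n (shift f)
  sumTo-suc zero    f = refl
  sumTo-suc (suc n) f = begin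
    sumTo R (suc n) f + f (suc (suc n))                ≈⟨ +-congʳ (sumTo-suc n f) ⟩
    (f 0 + sumTo R n (shift f)) + f (suc (suc n))      ≈⟨ +-assoc _ _ _ ⟩
    f 0 + sumTo R (suc n) (shift f)                    ∎

  binomialSum : ℕ → Seq → Carrier
  binomialSum n f = sumTo R n (λ k → (n C k) × f k)

  binomialSum-cong : ∀ n {f g : Seq} → (∀ {k} → k ≤ n → f k ≈ g k) →
                     binomialSum n f ≈ binomialSum n g
  binomialSum-cong n f≈g = sumTo-cong n (λ {k} k≤n → ×-congʳ (n C k) (f≈g k≤n))

  binomialSum-distrib-+ : ∀ n (f g : Seq) →
                          binomialSum n (λ k → f k + g k) ≈ binomialSum n f + binomialSum n g
  binomialSum-distrib-+ n f g = begin
    binomialSum n (λ k → f k + g k)                        ≈⟨ sumTo-cong n (λ {k} _ → ×-distrib-+ (f k) (g k) (n C k)) ⟩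
    sumTo R n (λ k → (n C k) × f k + (n C k) × g k)        ≈⟨ sumTo-distrib-+ n _ _ ⟩
    binomialSum n f + binomialSum n g                      ∎

  *-distribˡ-binomialSum : ∀ n x (f : Seq) → x * binomialSum n f ≈ binomialSum n (λ k → x * f k)
  *-distribˡ-binomialSum n x f = begin
    x * binomialSum n f                      ≈⟨ *-distribˡ-sumTo n x _ ⟩
    sumTo R n (λ k → x * (n C k) × f k)      ≈⟨ sumTo-cong n (λ {k} _ → ×-comm-* (n C k) x (f k)) ⟩
    binomialSum n (λ k → x * f k)            ∎

  -- Pascal's rule, after padding the first sum with the vanishing term C(n, n+1) × f (n+1).
  binomialSum-suc : ∀ n (f : Seq) → binomialSum (suc n) f ≈ binomialSum n f + binomialSum n (shift f)
  binomialSum-suc n f = begin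
    binomialSum (suc n) f
      ≈⟨ sumTo-suc n _ ⟩
    1 × f 0 + sumTo R n (λ k → (suc n C suc k) × f (suc k))
      ≈⟨ +-congˡ (sumTo-cong n (λ {k} _ → pascal k)) ⟩
    1 × f 0 + sumTo R n (λ k → (n C suc k) × f (suc k) + (n C k) × f (suc k))
      ≈⟨ +-congˡ (sumTo-distrib-+ n _ _) ⟩
    1 × f 0 + (sumTo R n (λ k → (n C suc k) × f (suc k)) + binomialSum n (shift f))
      ≈⟨ +-assoc _ _ _ ⟨
    (1 × f 0 + sumTo R n (λ k → (n C suc k) × f (suc k))) + binomialSum n (shift f)
      ≈⟨ +-congʳ (sumTo-suc n _) ⟨
    sumTo R (suc n) (λ k → (n C k) × f k) + binomialSum n (shift f)
      ≈⟨ +-congʳ (+-congˡ (reflexive (cong (_× f (suc n)) (k>n⇒nCk≡0 (n<1+n n))))) ⟩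
    (binomialSum n f + 0 × f (suc n)) + binomialSum n (shift f)
      ≈⟨ +-congʳ (+-identityʳ _) ⟩
    binomialSum n f + binomialSum n (shift f)
      ∎
    where
    pascal : ∀ k → (suc n C suc k) × f (suc k) ≈ (n C suc k) × f (suc k) + (n C k) × f (suc k)
    pascal k = begin
      (suc n C suc k) × f (suc k)                    ≈⟨ reflexive (cong (_× f (suc k)) (nCk+nC[k+1]≡[n+1]C[k+1] n k)) ⟨
      (n C k +ℕ n C suc k) × f (suc k)               ≈⟨ ×-homo-+ (f (suc k)) (n C k) _ ⟩
      (n C k) × f (suc k) + (n C suc k) × f (suc k)  ≈⟨ +-comm _ _ ⟩
      (n C suc k) × f (suc k) + (n C k) × f (suc k)  ∎

  binomialTransform : Seq → Seq
  binomialTransform a n = binomialSum n a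

  alternatingConvolution : ℕ → Seq → Seq → Carrier
  alternatingConvolution n a b = binomialSum n (λ k → negOnePow R k * (a k * b (n ∸ k)))

  alternatingConvolution-cong : ∀ n {a a′ b b′ : Seq} → (∀ k → a k ≈ a′ k) → (∀ k → b k ≈ b′ k) →
                                alternatingConvolution n a b ≈ alternatingConvolution n a′ b′
  alternatingConvolution-cong n a≈a′ b≈b′ =
    binomialSum-cong n (λ {k} _ → *-congˡ (*-cong (a≈a′ k) (b≈b′ (n ∸ k))))

  alternatingConvolution-distribˡ-+ : ∀ n (a b b′ : Seq) →
    alternatingConvolution n a (λ k → b k + b′ k)
      ≈ alternatingConvolution n a b + alternatingConvolution n a b′
  alternatingConvolution-distribˡ-+ n a b b′ = begin
    alternatingConvolution n a (λ k → b k + b′ k)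
      ≈⟨ binomialSum-cong n (λ _ → trans (*-congˡ (distribˡ _ _ _)) (distribˡ _ _ _)) ⟩
    binomialSum n (λ k → negOnePow R k * (a k * b (n ∸ k)) + negOnePow R k * (a k * b′ (n ∸ k)))
      ≈⟨ binomialSum-distrib-+ n _ _ ⟩
    alternatingConvolution n a b + alternatingConvolution n a b′
      ∎

  alternatingConvolution-distribʳ-+ : ∀ n (a a′ b : Seq) →
    alternatingConvolution n (λ k → a k + a′ k) b
      ≈ alternatingConvolution n a b + alternatingConvolution n a′ b
  alternatingConvolution-distribʳ-+ n a a′ b = begin
    alternatingConvolution n (λ k → a k + a′ k) b
      ≈⟨ binomialSum-cong n (λ _ → trans (*-congˡ (distribʳ _ _ _)) (distribˡ _ _ _)) ⟩
    binomialSum n (λ k → negOnePow R k * (a k * b (n ∸ k)) + negOnePow R k * (a′ k * b (n ∸ k)))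
      ≈⟨ binomialSum-distrib-+ n _ _ ⟩
    alternatingConvolution n a b + alternatingConvolution n a′ b
      ∎

  alternatingConvolution-suc : ∀ n (a b : Seq) →
    alternatingConvolution (suc n) a b
      ≈ alternatingConvolution n a (shift b) - alternatingConvolution n (shift a) b
  alternatingConvolution-suc n a b = begin
    alternatingConvolution (suc n) a b
      ≈⟨ binomialSum-suc n _ ⟩
    binomialSum n (λ k → negOnePow R k * (a k * b (suc n ∸ k)))
      + binomialSum n (λ k → (- 1# * negOnePow R k) * (a (suc k) * b (n ∸ k)))
      ≈⟨ +-cong (binomialSum-cong n suc∸k) (binomialSum-cong n (λ _ → *-assoc _ _ _)) ⟩
    alternatingConvolution n a (shift b)
      + binomialSum n (λ k → - 1# * (negOnePow R k * (a (suc k) * b (n ∸ k))))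
      ≈⟨ +-congˡ (*-distribˡ-binomialSum n (- 1#) _) ⟨
    alternatingConvolution n a (shift b) + - 1# * alternatingConvolution n (shift a) b
      ≈⟨ +-congˡ (-1*x≈-x _) ⟩
    alternatingConvolution n a (shift b) - alternatingConvolution n (shift a) b
      ∎
    where
    suc∸k : ∀ {k} → k ≤ n →
            negOnePow R k * (a k * b (suc n ∸ k)) ≈ negOnePow R k * (a k * b (suc (n ∸ k)))
    suc∸k {k} k≤n = reflexive (cong (λ j → negOnePow R k * (a k * b j)) (+-∸-assoc 1 k≤n))

  [x+y]-[x+z]≈y-z : ∀ x y z → (x + y) - (x + z) ≈ y - z
  [x+y]-[x+z]≈y-z x y z = begin
    (x + y) - (x + z)      ≈⟨ +-congˡ (-‿+-comm x z) ⟨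
    (x + y) + (- x - z)    ≈⟨ interchange x y (- x) (- z) ⟩
    (x - x) + (y - z)      ≈⟨ +-congʳ (-‿inverseʳ x) ⟩
    0# + (y - z)           ≈⟨ +-identityˡ _ ⟩
    y - z                  ∎

  alternatingConvolution-binomialTransform : ∀ n (a b : Seq) →
    alternatingConvolution n (binomialTransform a) (binomialTransform b) ≈ alternatingConvolution n a b
  alternatingConvolution-binomialTransform zero a b =
    alternatingConvolution-cong 0 (λ k → +-identityʳ (a k)) (λ k → +-identityʳ (b k))
  alternatingConvolution-binomialTransform (suc n) a b = begin
    ⟪ suc n ⟫ Ta Tb
      ≈⟨ alternatingConvolution-suc n Ta Tb ⟩
    ⟪ n ⟫ Ta (shift Tb) - ⟪ n ⟫ (shift Ta) Tb
      ≈⟨ sub-cong (alternatingConvolution-cong n {a = Ta} (λ _ → refl) (λ m → binomialSum-suc m b))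
                  (alternatingConvolution-cong n {b = Tb} (λ m → binomialSum-suc m a) (λ _ → refl)) ⟩
    ⟪ n ⟫ Ta (λ m → Tb m + T (shift b) m) - ⟪ n ⟫ (λ m → Ta m + T (shift a) m) Tb
      ≈⟨ sub-cong (alternatingConvolution-distribˡ-+ n Ta Tb (T (shift b)))
                  (alternatingConvolution-distribʳ-+ n Ta (T (shift a)) Tb) ⟩
    (⟪ n ⟫ Ta Tb + ⟪ n ⟫ Ta (T (shift b))) - (⟪ n ⟫ Ta Tb + ⟪ n ⟫ (T (shift a)) Tb)
      ≈⟨ [x+y]-[x+z]≈y-z _ _ _ ⟩
    ⟪ n ⟫ Ta (T (shift b)) - ⟪ n ⟫ (T (shift a)) Tb
      ≈⟨ sub-cong (alternatingConvolution-binomialTransform n a (shift b))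
                  (alternatingConvolution-binomialTransform n (shift a) b) ⟩
    ⟪ n ⟫ a (shift b) - ⟪ n ⟫ (shift a) b
      ≈⟨ alternatingConvolution-suc n a b ⟨
    ⟪ suc n ⟫ a b
      ∎
    where
    ⟪_⟫ : ℕ → Seq → Seq → Carrier
    ⟪_⟫ = alternatingConvolution
    T : Seq → Seq
    T = binomialTransform
    Ta Tb : Seq
    Ta = T a
    Tb = T b
    sub-cong : ∀ {x x′ y y′} → x ≈ x′ → y ≈ y′ → x - y ≈ x′ - y′
    sub-cong x≈x′ y≈y′ = +-cong x≈x′ (-‿cong y≈y′)

  natMul≡× : ∀ m x → natMul R m x ≡ m × x
  natMul≡× zero    x = ≡.refl
  natMul≡× (suc m) x = cong (x +_) (natMul≡× m x)

  IsBinomialPair2⇒≈binomialTransform : ∀ {s σ : Seq} → IsBinomialPair2 R s σ →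
                                       ∀ n → σ n ≈ binomialTransform s n
  IsBinomialPair2⇒≈binomialTransform {s} pair n =
    trans (pair n) (sumTo-cong n (λ {k} _ → reflexive (natMul≡× (n C k) (s k))))

  sumTo≈alternatingConvolution : ∀ n (a b : Seq) →
    sumTo R n (λ k → negOnePow R k * natMul R (n C k) (a k * b (n ∸ k))) ≈ alternatingConvolution n a b
  sumTo≈alternatingConvolution n a b = sumTo-cong n (λ {k} _ → begin
    negOnePow R k * natMul R (n C k) (a k * b (n ∸ k))  ≈⟨ *-congˡ (reflexive (natMul≡× (n C k) _)) ⟩
    negOnePow R k * (n C k) × (a k * b (n ∸ k))         ≈⟨ ×-comm-* (n C k) _ _ ⟩
    (n C k) × (negOnePow R k * (a k * b (n ∸ k)))       ∎)

theorem5 : {c ℓ : Level} (R : CommutativeRing c ℓ) →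
    let open CommutativeRing R in
    (s σ t τ : ℕ → Carrier) →
    IsBinomialPair2 R s σ → IsBinomialPair2 R t τ →
    (n : ℕ) →
    sumTo R n (λ k → negOnePow R k * natMul R (n C k) (s k * t (n ∸ k)))
      ≈ sumTo R n (λ k → negOnePow R k * natMul R (n C k) (σ k * τ (n ∸ k)))
theorem5 R s σ t τ s↦σ t↦τ n = begin
  _
    ≈⟨ sumTo≈alternatingConvolution n s t ⟩
  alternatingConvolution n s t
    ≈⟨ alternatingConvolution-binomialTransform n s t ⟨
  alternatingConvolution n (binomialTransform s) (binomialTransform t)
    ≈⟨ alternatingConvolution-cong n (IsBinomialPair2⇒≈binomialTransform s↦σ)
                                     (IsBinomialPair2⇒≈binomialTransform t↦τ) ⟨
  alternatingConvolution n σ τ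
    ≈⟨ sumTo≈alternatingConvolution n σ τ ⟨
  _ ∎
  where
  open CommutativeRing R using (setoid)
  open SetoidReasoning setoid
  open BinomialConvolution R
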